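{- A splittable tree set is ever-branching if and only if it has no splitting two-star.
   Context: A separation system is a poset $(\vec S,\le)$ with an order-reversing involution $\vec s\mapsto\overleftarrow s$; $s=\{\vec s,\overleftarrow s\}$ is the unoriented separation. Unoriented $r,s$ are nested if some orientation of $r$ is $\le$ some orientation of $s$. $\vec s$ is degenerate if $\vec s=\overleftarrow s$; $\vec r$ is trivial if there is $s$ with $\vec r<\vec s$ and $\vec r<\overleftarrow s$ (strictly). A tree set is a separation system in which any two separations are nested and which has no degenerate and no trivial elements. Write $\vec r\lneqq\vec s$ if $\vec r\le\vec s$ and $r\ne s$. A star is a set $\sigma$ with $\vec r\le\overleftarrow s$ for all distinct $\vec r,\vec s\in\sigma$; it is proper if it does not contain both orientations of any separation. An orientation contains exactly one orientation of every unoriented separation; it is consistent if there are no $\vec r,\vec s\in O$ with $r\ne s$ and $\overleftarrow r\le\vec s$. $\sigma$ is a splitting star of $\tau$ if $\tau$ has a consistent orientation $O$ all of whose elements lie below elements of $\sigma$ and whose set of maximal elements is $\sigma$; a splitting two-star is a splitting star with exactly two elements. A tree set is ever-branching if it contains no inclusion-maximal proper star with exactly two elements. A tree set $\tau$ is splittable if for all $\vec r\lneqq\vec s$ in $\tau$ there are $\vec r',\vec s'\in\tau$ with $\vec r\le\vec r'\lneqq\vec s'\le\vec s$ such that $\vec r'$ and $\overleftarrow{s'}$ lie in a common splitting star of $\tau$. -}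

module Defs where

open import Data.Product using (Σ; ∃; ∃-syntax; _×_; _,_)
open import Data.Sum using (_⊎_)
open import Relation.Nullary using (¬_)
open import Relation.Binary.PropositionalEquality using (_≡_; _≢_)
open import Relation.Binary.Structures using (IsPartialOrder)
open import Relation.Unary using (Pred; _∈_; _⊆_)
open import Function.Bundles using (_⇔_)
open import Level using (0ℓ)

record SepSys : Set₁ where
  infix 4 _≤_
  infix 10 _*
  field
    Carrier        : Set
    _≤_            : Carrier → Carrier → Set
    isPartialOrder : IsPartialOrder _≡_ _≤_
    _*             : Carrier → Carrier
    involutive     : ∀ s → (s *) * ≡ s
    reversing      : ∀ {r s} → r ≤ s → s * ≤ r *

module _ (S : SepSys) where
  open SepSys S

  SSet : Set₁
  SSet = Pred Carrier 0ℓ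

  -- r and s have the same underlying unoriented separation
  SameSep : Carrier → Carrier → Set
  SameSep r s = r ≡ s ⊎ r ≡ s *

  Nested : Carrier → Carrier → Set
  Nested r s = (r ≤ s) ⊎ (r ≤ s *) ⊎ (r * ≤ s) ⊎ (r * ≤ s *)

  Degenerate : Carrier → Set
  Degenerate s = s ≡ s *

  infix 4 _<_ _≨_
  _<_ : Carrier → Carrier → Set
  r < s = r ≤ s × r ≢ s

  Trivial : Carrier → Set
  Trivial r = ∃[ s ] (r < s × r < s *)

  record IsTreeSet : Set where
    field
      nested         : ∀ r s → Nested r s
      nonDegenerate  : ∀ s → ¬ Degenerate s
      nonTrivial     : ∀ r → ¬ Trivial r

  _≨_ : Carrier → Carrier → Set
  r ≨ s = r ≤ s × ¬ SameSep r s

  IsStar : SSet → Set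
  IsStar σ = ∀ r s → r ∈ σ → s ∈ σ → r ≢ s → r ≤ s *

  IsProperStar : SSet → Set
  IsProperStar σ = IsStar σ × (∀ s → s ∈ σ → ¬ (s * ∈ σ))

  IsOrientation : SSet → Set
  IsOrientation O = (∀ s → s ∈ O ⊎ s * ∈ O) × (∀ s → s ∈ O → ¬ (s * ∈ O))

  IsConsistent : SSet → Set
  IsConsistent O = ∀ r s → r ∈ O → s ∈ O → ¬ SameSep r s → ¬ (r * ≤ s)

  IsMaximalIn : SSet → Carrier → Set
  IsMaximalIn O x = x ∈ O × (∀ y → y ∈ O → x ≤ y → x ≡ y)

  IsSplittingStar : SSet → Set₁
  IsSplittingStar σ =
    IsStar σ ×
    ∃[ O ] ( IsOrientation O × IsConsistent O
           × (∀ x → x ∈ O → ∃[ y ] (y ∈ σ × x ≤ y))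
           × (∀ x → (x ∈ σ) ⇔ IsMaximalIn O x) )

  HasExactlyTwo : SSet → Set
  HasExactlyTwo σ = ∃[ a ] ∃[ b ] (a ≢ b × (∀ x → (x ∈ σ) ⇔ (x ≡ a ⊎ x ≡ b)))

  HasSplittingTwoStar : Set₁
  HasSplittingTwoStar = ∃[ σ ] (IsSplittingStar σ × HasExactlyTwo σ)

  IsInclMaxProperStar : SSet → Set₁
  IsInclMaxProperStar σ =
    IsProperStar σ × (∀ σ' → IsProperStar σ' → σ ⊆ σ' → σ' ⊆ σ)

  IsEverBranching : Set₁
  IsEverBranching = ¬ (∃[ σ ] (IsInclMaxProperStar σ × HasExactlyTwo σ))

  IsSplittable : Set₁
  IsSplittable = ∀ r s → r ≨ s →
    ∃[ r' ] ∃[ s' ] ( r ≤ r' × r' ≨ s' × s' ≤ s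
                    × ∃[ σ ] (IsSplittingStar σ × r' ∈ σ × s' * ∈ σ) )

module Submission where

open import Defs
open import Relation.Nullary using (¬_; yes; no)
open import Function.Bundles using (_⇔_)
open import Level using (0ℓ)
open import Axiom.ExcludedMiddle using (ExcludedMiddle)

open import Axiom.DoubleNegationElimination using (em⇒dne)
open import Data.Empty using (⊥-elim)
open import Data.Product using (∃-syntax; _×_; _,_; proj₁; proj₂)
open import Data.Sum using (_⊎_; inj₁; inj₂; [_,_])
open import Function.Bundles using (mk⇔; module Equivalence)
open import Relation.Binary.PropositionalEquality
  using (_≡_; _≢_; refl; sym; trans; subst)
open import Relation.Binary.Structures using (IsPartialOrder)
open import Relation.Unary using (_⊆_; _∪_; ｛_｝)

-- An inclusion-maximal proper star σ absorbs every t pointing towards all of its elements,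
-- since σ ∪ {t} is again a proper star.  A splitting star is such a maximal star, and
-- conversely, splitting the relation a ≤ b* of a maximal two-star {a, b} yields a splitting
-- star τ ∋ r', s'* with a ≤ r' and b ≤ s'*; any further t ∈ τ would point towards a and b,
-- hence lie in {a, b}, which makes t trivial.  So τ is a splitting two-star.

module _ (S : SepSys) where
  open SepSys S
  open IsPartialOrder isPartialOrder using (antisym) renaming (trans to ≤-trans)
  open Equivalence using (to; from)

  private
    variable
      r s t u x : Carrier
      σ τ : SSet S

  *-≡-swap : r * ≡ s → r ≡ s *
  *-≡-swap {r} refl = sym (involutive r)

  *-≤-swap : r ≤ s * → s ≤ r *
  *-≤-swap {r} {s} p = subst (_≤ r *) (involutive s) (reversing p)

  properStar-≤⇒¬SameSep : (∀ r → ¬ Trivial S r) → IsProperStar S τ →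
                          τ t → τ u → t ≢ u → x ≤ u → ¬ SameSep S x t
  properStar-≤⇒¬SameSep ¬trivial (star , proper) τt τu t≢u t≤u (inj₁ refl) =
    ¬trivial _ (_ , (t≤u , t≢u) , (star _ _ τt τu t≢u , λ t≡u* → proper _ τu (subst _ t≡u* τt)))
  properStar-≤⇒¬SameSep {τ = τ} {t} {u} _ (star , proper) τt τu t≢u t*≤u (inj₂ refl) =
    proper u τu (subst τ t≡u* τt)
    where
      t≡u* : t ≡ u *
      t≡u* = antisym (star _ _ τt τu t≢u) (subst (u * ≤_) (involutive t) (reversing t*≤u))

  orientationOf : {O : SSet S} → (∀ s → O s ⊎ O (s *)) → ∀ x → ∃[ x' ] (SameSep S x' x × O x')
  orientationOf oriented x with oriented x
  ... | inj₁ Ox = x , inj₁ refl , Ox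
  ... | inj₂ Ox* = x * , inj₂ refl , Ox*

  splittingStar⇒properStar : IsSplittingStar S σ → IsProperStar S σ
  splittingStar⇒properStar {σ} (star , O , (_ , ¬both) , _ , _ , maximal) =
    star , λ s σs σs* → ¬both s (⊆O σs) (⊆O σs*)
    where
      ⊆O : σ ⊆ O
      ⊆O {x} σx = proj₁ (to (maximal x) σx)

  splittingStar⇒inclMaxProperStar : ExcludedMiddle 0ℓ → (∀ r → ¬ Trivial S r) →
                                    IsSplittingStar S σ → IsInclMaxProperStar S σ
  splittingStar⇒inclMaxProperStar {σ} em ¬trivial split@(_ , O , (oriented , _) , _ , below , _) =
    splittingStar⇒properStar split , maximal
    where
      maximal : ∀ σ' → IsProperStar S σ' → σ ⊆ σ' → σ' ⊆ σ
      maximal σ' σ'-proper σ⊆σ' {x} σ'x with orientationOf oriented x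
      ... | x' , x'~x , Ox' with below x' Ox'
      ...   | y , σy , x'≤y = subst σ (sym (em⇒dne em λ x≢y →
              properStar-≤⇒¬SameSep ¬trivial σ'-proper σ'x (σ⊆σ' σy) x≢y x'≤y x'~x)) σy

  inclMaxProperStar-absorb : (∀ s → ¬ Degenerate S s) → IsInclMaxProperStar S σ →
                             (∀ s → σ s → t ≤ s * × t ≢ s *) → σ t
  inclMaxProperStar-absorb {σ} {t} ¬degenerate ((star , proper) , maximal) towards =
    maximal (σ ∪ ｛ t ｝) (star' , proper') inj₁ (inj₂ refl)
    where
      star' : IsStar S (σ ∪ ｛ t ｝)
      star' r s (inj₁ σr) (inj₁ σs) r≢s = star r s σr σs r≢s
      star' r s (inj₁ σr) (inj₂ refl) _ = *-≤-swap (proj₁ (towards r σr))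
      star' r s (inj₂ refl) (inj₁ σs) _ = proj₁ (towards s σs)
      star' r s (inj₂ refl) (inj₂ refl) r≢s = ⊥-elim (r≢s refl)
      proper' : ∀ s → (σ ∪ ｛ t ｝) s → ¬ (σ ∪ ｛ t ｝) (s *)
      proper' s (inj₁ σs) (inj₁ σs*) = proper s σs σs*
      proper' s (inj₁ σs) (inj₂ t≡s*) = proj₂ (towards s σs) t≡s*
      proper' s (inj₂ refl) (inj₁ σt*) = proj₂ (towards (t *) σt*) (sym (involutive t))
      proper' s (inj₂ refl) (inj₂ t≡t*) = ¬degenerate t t≡t*

  -- t points towards every element of σ, so it is absorbed into σ and then dominated itself.
  inclMaxProperStar-dominatedByOthers : (∀ s → ¬ Degenerate S s) → (∀ r → ¬ Trivial S r) →
                                        IsInclMaxProperStar S σ → IsProperStar S τ →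
                                        τ t → ¬ (∀ s → σ s → ∃[ u ] (τ u × t ≢ u × s ≤ u))
  inclMaxProperStar-dominatedByOthers {σ} {τ} {t} ¬degenerate ¬trivial
                                      σ-max τ-proper@(τ-star , _) τt dominated
    with dominated t (inclMaxProperStar-absorb ¬degenerate σ-max towards)
    where
      towards : ∀ s → σ s → t ≤ s * × t ≢ s *
      towards s σs with dominated s σs
      ... | u , τu , t≢u , s≤u =
        ≤-trans (τ-star t u τt τu t≢u) (reversing s≤u) ,
        λ t≡s* → properStar-≤⇒¬SameSep ¬trivial τ-proper τt τu t≢u s≤u (inj₂ (*-≡-swap (sym t≡s*)))
  ... | u , τu , t≢u , t≤u = properStar-≤⇒¬SameSep ¬trivial τ-proper τt τu t≢u t≤u (inj₁ refl)

  inclMaxTwoStar⇒splittingTwoStar : ExcludedMiddle 0ℓ →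
                                    (∀ s → ¬ Degenerate S s) → (∀ r → ¬ Trivial S r) → IsSplittable S →
                                    IsInclMaxProperStar S σ → HasExactlyTwo S σ → HasSplittingTwoStar S
  inclMaxTwoStar⇒splittingTwoStar {σ} em ¬degenerate ¬trivial splittable
                                  σ-max@((star , proper) , _) (a , b , a≢b , two)
    with splittable a (b *) (star a b σa σb a≢b , a≁b*)
    where
      σa : σ a
      σa = from (two a) (inj₁ refl)
      σb : σ b
      σb = from (two b) (inj₂ refl)
      a≁b* : ¬ SameSep S a (b *)
      a≁b* (inj₁ a≡b*) = proper b σb (subst σ a≡b* σa)
      a≁b* (inj₂ a≡b**) = a≢b (trans a≡b** (involutive b))
  ... | r' , s' , a≤r' , (_ , r'≁s') , s'≤b* , τ , τ-split , τr' , τs'* =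
    τ , τ-split , r' , s' * , (λ r'≡s'* → r'≁s' (inj₂ r'≡s'*)) ,
    λ x → mk⇔ (onlyTwo x) [ (λ { refl → τr' }) , (λ { refl → τs'* }) ]
    where
      onlyTwo : ∀ x → τ x → x ≡ r' ⊎ x ≡ s' *
      onlyTwo x τx with em {x ≡ r' ⊎ x ≡ s' *}
      ... | yes listed = listed
      ... | no unlisted = ⊥-elim (inclMaxProperStar-dominatedByOthers ¬degenerate ¬trivial
                                    σ-max (splittingStar⇒properStar τ-split) τx dominated)
        where
          dominated : ∀ s → σ s → ∃[ u ] (τ u × x ≢ u × s ≤ u)
          dominated s σs with to (two s) σs
          ... | inj₁ refl = r' , τr' , (λ x≡r' → unlisted (inj₁ x≡r')) , a≤r'
          ... | inj₂ refl = s' * , τs'* , (λ x≡s'* → unlisted (inj₂ x≡s'*)) , *-≤-swap s'≤b*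

lemma4p2 : ExcludedMiddle 0ℓ → (S : SepSys) → IsTreeSet S → IsSplittable S →
    (IsEverBranching S ⇔ (¬ HasSplittingTwoStar S))
lemma4p2 em S T splittable = mk⇔
  (λ everBranching (σ , σ-split , two) →
     everBranching (σ , splittingStar⇒inclMaxProperStar S em nonTrivial σ-split , two))
  (λ noSplittingTwoStar (σ , σ-max , two) →
     noSplittingTwoStar
       (inclMaxTwoStar⇒splittingTwoStar S em nonDegenerate nonTrivial splittable σ-max two))
  where open IsTreeSet T
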